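{- Let $w$ be a nonempty p-string with $\Pi_w\neq\emptyset$. For any $a\in\Sigma\cup\Pi$, if $\mathrm{period}(wa)\neq\mathrm{period}(w)$, then $\mathrm{period}(wa)>\frac{|w|}{|\Pi_w|+1}$.
   Context: Let $\Sigma$ and $\Pi$ be disjoint alphabets; a p-string is a string over $\Sigma\cup\Pi$, indexed from 0, with $w[i:j]=w[i]\cdots w[j-1]$. A permutation $f$ of $\Pi$ acts on p-strings letterwise, fixing letters of $\Sigma$; $x\equiv y$ iff $f(x)=y$ for some permutation $f$ of $\Pi$. For $p\in\mathbb{N}^+$, $p\le|w|$, $p$ is a period of $w$ iff $w[0:|w|-p]\equiv w[p:|w|]$; $\mathrm{period}(w)$ is the smallest period of a nonempty $w$. $\Pi_w$ is the set of parameter characters occurring in $w$. -}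

module Defs where

open import Data.Nat using (ℕ; _≤_; _<_; _∸_)
open import Data.List using (List; []; _∷_; map; take; drop; length)
open import Data.List.Membership.Propositional using (_∈_)
open import Data.List.Relation.Unary.Unique.Propositional using (Unique)
open import Data.Sum using (_⊎_; inj₁; inj₂; [_,_])
open import Data.Product using (Σ; _×_; ∃)
open import Function using (_∘_; id; _⇔_)
open import Function.Bundles using (_↔_; Inverse)
open import Relation.Binary.PropositionalEquality using (_≡_)
open import Relation.Nullary using (¬_)

-- Σ ⊎ Π : constant letters (inj₁) and parameter letters (inj₂); disjoint by construction.
PString : Set → Set → Set
PString S P = List (S ⊎ P)

act : {S P : Set} → (P ↔ P) → PString S P → PString S P
act f = map [ inj₁ , inj₂ ∘ Inverse.to f ]

_≈p_ : {S P : Set} → PString S P → PString S P → Set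
x ≈p y = Σ (_ ↔ _) λ f → act f x ≡ y

IsPeriod : {S P : Set} → ℕ → PString S P → Set
IsPeriod p w = (1 ≤ p) × (p ≤ length w) × (take (length w ∸ p) w ≈p drop p w)

IsSmallestPeriod : {S P : Set} → ℕ → PString S P → Set
IsSmallestPeriod p w = IsPeriod p w × (∀ q → q < p → ¬ IsPeriod q w)

ParamCount : {S P : Set} → PString S P → ℕ → Set
ParamCount {S} {P} w k =
  Σ (List P) λ ps → Unique ps × (length ps ≡ k) × (∀ c → (c ∈ ps) ⇔ (inj₂ {A = S} c ∈ w))

-- Let F and G be parameter permutations witnessing p = period(wa) and q = period(w).
-- Since p is also a period of w, q < p; we show that if |w| ≥ p(k+1), k = |Π_w|, then q is
-- a period of wa as well, contradicting the minimality of p.  With ℓ the letter at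
-- |w| − p − q, the last letter a equals F(G ℓ) while period q predicts G(F ℓ), so F and G
-- must commute on ℓ.  They commute on w[t] whenever t + p + q < |w|, both sides being
-- w[t + p + q]; ℓ itself is just too close to the end.  Write ℓ = F^(k−1) c with c = w[s],
-- s = |w| − p − q − (k−1)p.  The k + 1 parameters c, F c, …, F^k c of w repeat, so F^d c = c
-- for some 0 < d ≤ k.  If d < k, then ℓ = F^(k−1−d) c also occurs at s + (k−1−d)p, early
-- enough to commute.  Otherwise c, …, F^(k−1) c are all k parameters, so G c = w[s + q] is
-- one of them, and reading G ℓ off the F-chain starting at s + q gives F(G ℓ) = G(F ℓ).
module Submission where

open import Defs
open import Data.Nat using (ℕ; _<_; _*_; suc)
open import Data.List using (List; []; _∷_; _++_; length)
open import Data.List.Membership.Propositional using (_∈_)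
open import Data.Sum using (_⊎_; inj₂)
open import Data.Product using (∃)
open import Relation.Binary.PropositionalEquality using (_≡_; _≢_)

open import Data.Nat using (zero; _+_; _∸_; _≤_; z≤n; s≤s; _<?_; >-nonZero)
open import Data.Nat.Properties
open import Data.Nat.GeneralisedArithmetic using (fold; fold-+)
open import Data.Maybe using (Maybe; just; nothing)
import Data.Maybe as Maybe
open import Data.Maybe.Properties using (just-injective)
open import Data.List using (map; take; drop; lookup)
open import Data.List.Properties using (length-++; length-take)
open import Data.List.Relation.Unary.Any using (here; there; index)
open import Data.List.Relation.Unary.Any.Properties using (lookup-index)
open import Data.Sum using (inj₁; map₂; [_,_]′)
open import Data.Sum.Properties using (inj₂-injective)
open import Data.Product using (∃₂; _,_; _×_; proj₁; proj₂)
open import Data.Fin as Fin using (Fin; toℕ)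
open import Data.Fin.Properties using (pigeonhole; toℕ<n)
open import Data.Empty using (⊥; ⊥-elim)
open import Function using (_∘_; _↔_; Injective; Injection; Inverse; Equivalence)
open import Function.Properties.Inverse using (↔⇒↣)
open import Relation.Nullary using (yes; no)
open import Relation.Binary.PropositionalEquality using (refl; sym; trans; cong; subst; module ≡-Reasoning)
open import Algebra.Properties.CommutativeSemigroup +-commutativeSemigroup using (x∙yz≈y∙xz)
open ≡-Reasoning

private variable
  A B : Set

infixl 5 _!_

_!_ : List A → ℕ → Maybe A
[] ! i = nothing
(x ∷ xs) ! zero = just x
(x ∷ xs) ! suc i = xs ! i

!-map : (h : A → B) (xs : List A) (i : ℕ) → map h xs ! i ≡ Maybe.map h (xs ! i)
!-map h [] i = refl
!-map h (x ∷ xs) zero = refl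
!-map h (x ∷ xs) (suc i) = !-map h xs i

!-drop : ∀ p (xs : List A) i → drop p xs ! i ≡ xs ! (p + i)
!-drop zero xs i = refl
!-drop (suc p) [] i = refl
!-drop (suc p) (x ∷ xs) i = !-drop p xs i

!-take : ∀ m (xs : List A) {i} → i < m → take m xs ! i ≡ xs ! i
!-take (suc m) [] _ = refl
!-take (suc m) (x ∷ xs) {zero} _ = refl
!-take (suc m) (x ∷ xs) {suc i} (s≤s i<m) = !-take m xs i<m

!-≥length : (xs : List A) {i : ℕ} → length xs ≤ i → xs ! i ≡ nothing
!-≥length [] _ = refl
!-≥length (x ∷ xs) {suc i} (s≤s le) = !-≥length xs le

!-<length : (xs : List A) {i : ℕ} → i < length xs → ∃ λ x → xs ! i ≡ just x
!-<length (x ∷ xs) {zero} _ = x , refl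
!-<length (x ∷ xs) {suc i} (s≤s lt) = !-<length xs lt

!-just⇒<length : (xs : List A) {i : ℕ} {x : A} → xs ! i ≡ just x → i < length xs
!-just⇒<length (x ∷ xs) {zero} _ = s≤s z≤n
!-just⇒<length (x ∷ xs) {suc i} eq = s≤s (!-just⇒<length xs eq)

!-∈ : (xs : List A) {i : ℕ} {x : A} → xs ! i ≡ just x → x ∈ xs
!-∈ (x ∷ xs) {zero} refl = here refl
!-∈ (x ∷ xs) {suc i} eq = there (!-∈ xs eq)

!-++ˡ : (xs : List A) {ys : List A} {i : ℕ} → i < length xs → (xs ++ ys) ! i ≡ xs ! i
!-++ˡ (x ∷ xs) {i = zero} _ = refl
!-++ˡ (x ∷ xs) {i = suc i} (s≤s lt) = !-++ˡ xs lt

!-++-length : (xs : List A) {y : A} {ys : List A} → (xs ++ y ∷ ys) ! length xs ≡ just y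
!-++-length [] = refl
!-++-length (x ∷ xs) = !-++-length xs

!-ext : (xs ys : List A) → (∀ i → xs ! i ≡ ys ! i) → xs ≡ ys
!-ext [] [] _ = refl
!-ext [] (y ∷ ys) eq with eq zero
... | ()
!-ext (x ∷ xs) [] eq with eq zero
... | ()
!-ext (x ∷ xs) (y ∷ ys) eq with eq zero
... | refl = cong (x ∷_) (!-ext xs ys (eq ∘ suc))

length-snoc : (xs : List A) {y : A} → length (xs ++ y ∷ []) ≡ suc (length xs)
length-snoc xs = trans (length-++ xs) (+-comm (length xs) 1)

Periodic : (A → A) → ℕ → List A → Set
Periodic h p w = ∀ i → p + i < length w → w ! (p + i) ≡ Maybe.map h (w ! i)

map-take-! : (h : A → A) {p : ℕ} (w : List A) {i : ℕ} → p + i < length w →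
             map h (take (length w ∸ p) w) ! i ≡ Maybe.map h (w ! i)
map-take-! h {p} w {i} lt = trans (!-map h (take (length w ∸ p) w) i) (cong (Maybe.map h) (!-take _ w i<n∸p))
  where
  i<n∸p : i < length w ∸ p
  i<n∸p = subst (_< length w ∸ p) (m+n∸m≡n p i) (∸-monoˡ-< lt (m≤m+n p i))

map-take≡drop⇒periodic : {h : A → A} {p : ℕ} (w : List A) →
                         map h (take (length w ∸ p) w) ≡ drop p w → Periodic h p w
map-take≡drop⇒periodic {h = h} {p} w eq i lt = begin
  w ! (p + i)                        ≡⟨ !-drop p w i ⟨
  drop p w ! i                       ≡⟨ cong (_! i) eq ⟨
  map h (take (length w ∸ p) w) ! i  ≡⟨ map-take-! h w lt ⟩
  Maybe.map h (w ! i)                ∎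

periodic⇒map-take≡drop : {h : A → A} {p : ℕ} (w : List A) →
                         Periodic h p w → map h (take (length w ∸ p) w) ≡ drop p w
periodic⇒map-take≡drop {h = h} {p} w per = !-ext _ _ pointwise
  where
  pointwise : ∀ i → map h (take (length w ∸ p) w) ! i ≡ drop p w ! i
  pointwise i with p + i <? length w
  ... | yes lt = begin
    map h (take (length w ∸ p) w) ! i  ≡⟨ map-take-! h w lt ⟩
    Maybe.map h (w ! i)                ≡⟨ per i lt ⟨
    w ! (p + i)                        ≡⟨ !-drop p w i ⟨
    drop p w ! i                       ∎
  ... | no ≮ = begin
    map h (take (length w ∸ p) w) ! i        ≡⟨ !-map h (take (length w ∸ p) w) i ⟩
    Maybe.map h (take (length w ∸ p) w ! i)  ≡⟨ cong (Maybe.map h) (!-≥length (take (length w ∸ p) w) short) ⟩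
    nothing                                  ≡⟨ !-≥length w (≮⇒≥ ≮) ⟨
    w ! (p + i)                              ≡⟨ !-drop p w i ⟨
    drop p w ! i                             ∎
    where
    short : length (take (length w ∸ p) w) ≤ i
    short = subst (_≤ i) (sym (length-take _ w))
              (≤-trans (m⊓n≤m _ _) (m≤n+o⇒m∸n≤o (length w) p (≮⇒≥ ≮)))

periodic-++ˡ : {h : A → A} {p : ℕ} (w : List A) {v : List A} → Periodic h p (w ++ v) → Periodic h p w
periodic-++ˡ {h = h} {p} w {v} per i lt = begin
  w ! (p + i)                 ≡⟨ !-++ˡ w lt ⟨
  (w ++ v) ! (p + i)          ≡⟨ per i (<-≤-trans lt w≤w++v) ⟩
  Maybe.map h ((w ++ v) ! i)  ≡⟨ cong (Maybe.map h) (!-++ˡ w (≤-<-trans (m≤n+m i p) lt)) ⟩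
  Maybe.map h (w ! i)         ∎
  where
  w≤w++v : length w ≤ length (w ++ v)
  w≤w++v = subst (length w ≤_) (sym (length-++ w)) (m≤m+n (length w) (length v))

periodic-snoc : {h : A → A} {p : ℕ} (w : List A) {a b : A} (i : ℕ) →
                p + i ≡ length w → w ! i ≡ just b → h b ≡ a →
                Periodic h p w → Periodic h p (w ++ a ∷ [])
periodic-snoc {h = h} {p} w {a} {b} i end wi hb≡a per j lt
  with m≤n⇒m<n∨m≡n (≤-pred (subst (p + j <_) (length-snoc w) lt))
... | inj₁ inside = begin
  (w ++ a ∷ []) ! (p + j)          ≡⟨ !-++ˡ w inside ⟩
  w ! (p + j)                      ≡⟨ per j inside ⟩
  Maybe.map h (w ! j)              ≡⟨ cong (Maybe.map h) (!-++ˡ w (≤-<-trans (m≤n+m j p) inside)) ⟨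
  Maybe.map h ((w ++ a ∷ []) ! j)  ∎
... | inj₂ at-end with +-cancelˡ-≡ p j i (trans at-end (sym end))
... | refl = begin
  (w ++ a ∷ []) ! (p + j)          ≡⟨ cong ((w ++ a ∷ []) !_) end ⟩
  (w ++ a ∷ []) ! length w         ≡⟨ !-++-length w ⟩
  just a                           ≡⟨ cong just hb≡a ⟨
  just (h b)                       ≡⟨ cong (Maybe.map h) wi ⟨
  Maybe.map h (w ! j)              ≡⟨ cong (Maybe.map h) (!-++ˡ w (!-just⇒<length w wi)) ⟨
  Maybe.map h ((w ++ a ∷ []) ! j)  ∎

periodic-fold : {h : A → A} {p : ℕ} {w : List A} → Periodic h p w →
                ∀ {b x} → w ! b ≡ just x →
                ∀ j → b + j * p < length w → w ! (b + j * p) ≡ just (fold x h j)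
periodic-fold {w = w} per {b} wb zero _ = trans (cong (w !_) (+-identityʳ b)) wb
periodic-fold {h = h} {p} {w} per {b} {x} wb (suc j) b+[1+j]p<n = begin
  w ! (b + suc j * p)             ≡⟨ cong (w !_) (x∙yz≈y∙xz b p (j * p)) ⟩
  w ! (p + (b + j * p))           ≡⟨ per (b + j * p) lt′ ⟩
  Maybe.map h (w ! (b + j * p))   ≡⟨ cong (Maybe.map h) (periodic-fold {w = w} per wb j lt) ⟩
  just (h (fold x h j))           ∎
  where
  lt′ : p + (b + j * p) < length w
  lt′ = subst (_< length w) (x∙yz≈y∙xz b p (j * p)) b+[1+j]p<n
  lt : b + j * p < length w
  lt = ≤-<-trans (m≤n+m _ p) lt′

Commute : (A → A) → (A → A) → A → Set
Commute h g x = h (g x) ≡ g (h x)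

periodic-commute : {h g : A → A} {p q : ℕ} {w : List A} → Periodic h p w → Periodic g q w →
                   ∀ {t x} → p + (q + t) < length w → w ! t ≡ just x → Commute h g x
periodic-commute {h = h} {g} {p} {q} {w} h-per g-per {t} {x} lt wt = just-injective (begin
  just (h (g x))                     ≡⟨ cong (Maybe.map h ∘ Maybe.map g) wt ⟨
  Maybe.map h (Maybe.map g (w ! t))  ≡⟨ cong (Maybe.map h) (g-per t (≤-<-trans (m≤n+m (q + t) p) lt)) ⟨
  Maybe.map h (w ! (q + t))          ≡⟨ h-per (q + t) lt ⟨
  w ! (p + (q + t))                  ≡⟨ cong (w !_) (x∙yz≈y∙xz p q t) ⟩
  w ! (q + (p + t))                  ≡⟨ g-per (p + t) (subst (_< length w) (x∙yz≈y∙xz p q t) lt) ⟩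
  Maybe.map g (w ! (p + t))          ≡⟨ cong (Maybe.map g) (h-per t (≤-<-trans (+-monoʳ-≤ p (m≤n+m t q)) lt)) ⟩
  Maybe.map g (Maybe.map h (w ! t))  ≡⟨ cong (Maybe.map g ∘ Maybe.map h) wt ⟩
  just (g (h x))                     ∎)

-- fold x h j is h^j x.
fold-cancel : {h : A → A} → Injective _≡_ _≡_ h → ∀ i {x y} → fold x h i ≡ fold y h i → x ≡ y
fold-cancel inj zero eq = eq
fold-cancel inj (suc i) eq = fold-cancel inj i (inj eq)

fold-return : {h : A → A} → Injective _≡_ _≡_ h → ∀ {x i j} → i < j → fold x h i ≡ fold x h j →
              ∃ λ d → d < j × fold x h (suc d) ≡ x
fold-return {h = h} inj {x} {i} {j} i<j eq with m≤n⇒∃[o]m+o≡n i<j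
... | d , i+1+d≡j = d , subst (d <_) i+1+d≡j (s≤s (m≤n+m d i)) , fold-cancel inj i (begin
  fold (fold x h (suc d)) h i  ≡⟨ fold-+ x h i ⟨
  fold x h (i + suc d)         ≡⟨ cong (fold x h) (trans (+-suc i d) i+1+d≡j) ⟩
  fold x h j                   ≡⟨ eq ⟨
  fold x h i                   ∎)

pigeonhole-∈ : {xs : List A} {n : ℕ} (f : Fin n → A) → length xs < n → (∀ i → f i ∈ xs) →
               ∃₂ λ i j → i Fin.< j × f i ≡ f j
pigeonhole-∈ {xs = xs} f len<n f∈ with pigeonhole len<n (index ∘ f∈)
... | i , j , i<j , same-index = i , j , i<j ,
  trans (lookup-index (f∈ i)) (trans (cong (lookup xs) same-index) (sym (lookup-index (f∈ j))))

orbit-returns : {h : A → A} → Injective _≡_ _≡_ h → ∀ {xs : List A} {k x} → length xs ≡ k →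
                (∀ j → j ≤ k → fold x h j ∈ xs) → ∃ λ d → d < k × fold x h (suc d) ≡ x
orbit-returns {h = h} inj {x = x} len orbit∈
  with pigeonhole-∈ (fold x h ∘ toℕ) (s≤s (≤-reflexive len))
                    (λ i → orbit∈ (toℕ i) (≤-pred (toℕ<n i)))
... | i , j , i<j , eq with fold-return inj i<j eq
... | d , d<j , ret = d , <-≤-trans d<j (≤-pred (toℕ<n j)) , ret

orbit-returns-early-or-hits : {h : A → A} → Injective _≡_ _≡_ h → ∀ {xs : List A} {m x z} →
  length xs ≡ suc m → (∀ j → j ≤ m → fold x h j ∈ xs) → z ∈ xs →
  (∃ λ d → d < m × fold x h (suc d) ≡ x) ⊎ (∃ λ i → z ≡ fold x h i)
orbit-returns-early-or-hits {A = A} {h = h} inj {xs} {m} {x} {z} len orbit∈ z∈ =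
  conclude (pigeonhole-∈ g (s≤s (≤-reflexive len)) g∈)
  where
  g : Fin (suc (suc m)) → A
  g Fin.zero = z
  g (Fin.suc i) = fold x h (toℕ i)
  g∈ : ∀ i → g i ∈ xs
  g∈ Fin.zero = z∈
  g∈ (Fin.suc i) = orbit∈ (toℕ i) (≤-pred (toℕ<n i))
  conclude : (∃₂ λ i j → i Fin.< j × g i ≡ g j) →
             (∃ λ d → d < m × fold x h (suc d) ≡ x) ⊎ (∃ λ i → z ≡ fold x h i)
  conclude (Fin.zero , Fin.suc j , _ , z≡) = inj₂ (toℕ j , z≡)
  conclude (Fin.suc i , Fin.suc j , s≤s i<j , eq) with fold-return inj i<j eq
  ... | d , d<j , ret = inj₁ (d , <-≤-trans d<j (≤-pred (toℕ<n j)) , ret)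

orbit-returns-early-or-covers : {h : A → A} → Injective _≡_ _≡_ h → ∀ {xs : List A} {m x z} →
  length xs ≡ suc m → (∀ j → j ≤ suc m → fold x h j ∈ xs) → z ∈ xs →
  (∃ λ d → d < m × fold x h (suc d) ≡ x) ⊎ (fold x h (suc m) ≡ x × ∃ λ i → z ≡ fold x h i)
orbit-returns-early-or-covers inj len orbit∈ z∈ with orbit-returns inj len orbit∈
... | d , d<1+m , ret with m≤n⇒m<n∨m≡n (≤-pred d<1+m)
...   | inj₁ d<m = inj₁ (d , d<m , ret)
...   | inj₂ refl =
  map₂ (ret ,_) (orbit-returns-early-or-hits inj len (λ j j≤m → orbit∈ j (m≤n⇒m≤1+n j≤m)) z∈)

fold-map₂-inj₁ : {F : B → B} (j : ℕ) {x : A} → fold (inj₁ x) (map₂ F) j ≡ inj₁ x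
fold-map₂-inj₁ zero = refl
fold-map₂-inj₁ {F = F} (suc j) = cong (map₂ F) (fold-map₂-inj₁ j)

fold-map₂-inj₂ : {F : B → B} (j : ℕ) {c : B} → fold (inj₂ {A = A} c) (map₂ F) j ≡ inj₂ (fold c F j)
fold-map₂-inj₂ zero = refl
fold-map₂-inj₂ {F = F} (suc j) = cong (map₂ F) (fold-map₂-inj₂ j)

module _ {S P : Set} {w : PString S P} {F G : P → P} (F-inj : Injective _≡_ _≡_ F)
         {p q : ℕ} (p>0 : 0 < p) (q>0 : 0 < q)
         (F-per : Periodic (map₂ F) p w) (G-per : Periodic (map₂ G) q w)
         {ps : List P} {m : ℕ} (length-ps : length ps ≡ suc m) (ps-complete : ∀ c → inj₂ c ∈ w → c ∈ ps)
         where

  commute-on-orbit : ∀ {s c} → p + (q + (s + m * p)) ≡ length w → w ! s ≡ just (inj₂ c) →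
                     Commute F G (fold c F m)
  commute-on-orbit {s} {c} end ws =
    [ early , full ]′ (orbit-returns-early-or-covers F-inj length-ps orbit∈ Gc∈)
    where
    y = fold c F m
    t = s + m * p

    within : ∀ {i} → i < p + (q + t) → i < length w
    within = subst (_ <_) end

    p+t<n : p + t < length w
    p+t<n = within (+-monoʳ-< p (m<n+m t q>0))

    q+t<n : q + t < length w
    q+t<n = within (m<n+m (q + t) p>0)

    orbit : ∀ j → s + j * p < length w → w ! (s + j * p) ≡ just (inj₂ (fold c F j))
    orbit j lt = trans (periodic-fold {w = w} F-per ws j lt) (cong just (fold-map₂-inj₂ j))

    orbit∈ : ∀ j → j ≤ suc m → fold c F j ∈ ps
    orbit∈ j j≤ = ps-complete _ (!-∈ w (orbit j (≤-<-trans (+-monoʳ-≤ s (*-monoˡ-≤ p j≤)) s+[1+m]p<n)))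
      where
      s+[1+m]p<n : s + suc m * p < length w
      s+[1+m]p<n = subst (_< length w) (sym (x∙yz≈y∙xz s p (m * p))) p+t<n

    q+s<n : q + s < length w
    q+s<n = ≤-<-trans (+-monoʳ-≤ q (m≤m+n s (m * p))) q+t<n

    Gc : w ! (q + s) ≡ just (inj₂ (G c))
    Gc = trans (G-per s q+s<n) (cong (Maybe.map (map₂ G)) ws)

    Gc∈ : G c ∈ ps
    Gc∈ = ps-complete _ (!-∈ w Gc)

    early : (∃ λ d → d < m × fold c F (suc d) ≡ c) → Commute F G y
    early (d , d<m , ret) with m≤n⇒∃[o]m+o≡n d<m
    ... | r , 1+d+r≡m = subst (Commute F G) (sym y≡) (inj₂-injective commutes)
      where
      y≡ : y ≡ fold c F r
      y≡ = begin
        fold c F m                    ≡⟨ cong (fold c F) (trans (+-comm r (suc d)) 1+d+r≡m) ⟨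
        fold c F (r + suc d)          ≡⟨ fold-+ c F r ⟩
        fold (fold c F (suc d)) F r   ≡⟨ cong (λ z → fold z F r) ret ⟩
        fold c F r                    ∎
      r<m : r < m
      r<m = subst (r <_) 1+d+r≡m (m<n+m r (s≤s z≤n))
      room : p + (q + (s + r * p)) < length w
      room = within (+-monoʳ-< p (+-monoʳ-< q (+-monoʳ-< s (*-monoˡ-< p {{>-nonZero p>0}} r<m))))
      commutes : Commute (map₂ F) (map₂ G) (inj₂ (fold c F r))
      commutes = periodic-commute {w = w} F-per G-per room
                   (orbit r (≤-<-trans (m≤n+m _ q) (≤-<-trans (m≤n+m _ p) room)))

    full : fold c F (suc m) ≡ c × (∃ λ i → G c ≡ fold c F i) → Commute F G y
    full (ret , i , Gc≡) = begin
      F (G y)                           ≡⟨ cong F Gy≡ ⟩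
      fold (G c) F (suc m)              ≡⟨ cong (λ z → fold z F (suc m)) Gc≡ ⟩
      fold (fold c F i) F (suc m)       ≡⟨ fold-+ c F (suc m) ⟨
      fold c F (suc m + i)              ≡⟨ cong (fold c F) (+-comm (suc m) i) ⟩
      fold c F (i + suc m)              ≡⟨ fold-+ c F i ⟩
      fold (fold c F (suc m)) F i       ≡⟨ cong (λ z → fold z F i) ret ⟩
      fold c F i                        ≡⟨ Gc≡ ⟨
      G c                               ≡⟨ cong G ret ⟨
      G (F y)                           ∎
      where
      Gy≡ : G y ≡ fold (G c) F m
      Gy≡ = inj₂-injective (just-injective (begin
        just (inj₂ (G y))                 ≡⟨ cong (Maybe.map (map₂ G)) (orbit m (≤-<-trans (m≤n+m t q) q+t<n)) ⟨
        Maybe.map (map₂ G) (w ! t)        ≡⟨ G-per t q+t<n ⟨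
        w ! (q + t)                       ≡⟨ cong (w !_) (+-assoc q s (m * p)) ⟨
        w ! (q + s + m * p)               ≡⟨ periodic-fold {w = w} F-per Gc m
                                               (subst (_< length w) (sym (+-assoc q s (m * p))) q+t<n) ⟩
        just (fold (inj₂ (G c)) (map₂ F) m) ≡⟨ cong just (fold-map₂-inj₂ m) ⟩
        just (inj₂ (fold (G c) F m))      ∎))

  commute-at-end : ∀ {s ℓ} → p + (q + (s + m * p)) ≡ length w → w ! (s + m * p) ≡ just ℓ →
                   Commute (map₂ F) (map₂ G) ℓ
  commute-at-end {s} end wt =
    subst (Commute (map₂ F) (map₂ G)) (just-injective (trans (sym (periodic-fold {w = w} F-per ws m t<n)) wt))
      (commute-along ℓ₀ ws)
    where
    t<n : s + m * p < length w
    t<n = subst (_ <_) end (<-≤-trans (m<n+m _ q>0) (m≤n+m _ p))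
    ℓ₀ = proj₁ (!-<length w (≤-<-trans (m≤m+n s (m * p)) t<n))
    ws = proj₂ (!-<length w (≤-<-trans (m≤m+n s (m * p)) t<n))
    commute-along : ∀ ℓ₀ → w ! s ≡ just ℓ₀ → Commute (map₂ F) (map₂ G) (fold ℓ₀ (map₂ F) m)
    commute-along (inj₁ x) _ = subst (Commute (map₂ F) (map₂ G)) (sym (fold-map₂-inj₁ m)) refl
    commute-along (inj₂ c) ws =
      subst (Commute (map₂ F) (map₂ G)) (sym (fold-map₂-inj₂ m)) (cong inj₂ (commute-on-orbit end ws))

shorter-period-extends : {S P : Set} {w : PString S P} {a : S ⊎ P} {ps : List P} {m p q : ℕ}
  (f g : P ↔ P) → length ps ≡ suc m → (∀ c → inj₂ c ∈ w → c ∈ ps) →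
  0 < q → q < p → p * suc (suc m) ≤ length w →
  Periodic (map₂ (Inverse.to f)) p (w ++ a ∷ []) → Periodic (map₂ (Inverse.to g)) q w →
  Periodic (map₂ (Inverse.to g)) q (w ++ a ∷ [])
shorter-period-extends {w = w} {a} {m = m} {p} {q} f g length-ps ps-complete q>0 q<p long F-per-wa G-per =
  periodic-snoc w (p + t) (trans (x∙yz≈y∙xz q p t) end) w[p+t] (sym a≡) G-per
  where
  F = Inverse.to f
  G = Inverse.to g
  u = w ++ a ∷ []

  p>0 : 0 < p
  p>0 = <-trans q>0 q<p

  F-per : Periodic (map₂ F) p w
  F-per = periodic-++ˡ w F-per-wa

  fits : p + (q + m * p) ≤ length w
  fits = ≤-trans (+-monoʳ-≤ p (+-mono-≤ (<⇒≤ q<p) (≤-reflexive (*-comm m p))))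
           (≤-trans (≤-reflexive (sym (trans (*-suc p (suc m)) (cong (p +_) (*-suc p m))))) long)

  s = length w ∸ (p + (q + m * p))
  t = s + m * p

  end : p + (q + t) ≡ length w
  end = begin
    p + (q + (s + m * p))  ≡⟨ cong (p +_) (x∙yz≈y∙xz s q (m * p)) ⟨
    p + (s + (q + m * p))  ≡⟨ x∙yz≈y∙xz s p (q + m * p) ⟨
    s + (p + (q + m * p))  ≡⟨ +-comm s _ ⟩
    (p + (q + m * p)) + s  ≡⟨ m+[n∸m]≡n fits ⟩
    length w               ∎

  within : ∀ {i} → i < p + (q + t) → i < length w
  within = subst (_ <_) end

  p+t<n : p + t < length w
  p+t<n = within (+-monoʳ-< p (m<n+m t q>0))

  q+t<n : q + t < length w
  q+t<n = within (m<n+m (q + t) p>0)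

  ℓ = proj₁ (!-<length w (≤-<-trans (m≤n+m t q) q+t<n))
  wt = proj₂ (!-<length w (≤-<-trans (m≤n+m t q) q+t<n))

  w[p+t] : w ! (p + t) ≡ just (map₂ F ℓ)
  w[p+t] = trans (F-per t p+t<n) (cong (Maybe.map (map₂ F)) wt)

  commutes : Commute (map₂ F) (map₂ G) ℓ
  commutes = commute-at-end (Injection.injective (↔⇒↣ f)) p>0 q>0 F-per G-per length-ps ps-complete end wt

  end<|u| : p + (q + t) < length u
  end<|u| = subst (p + (q + t) <_) (sym (length-snoc w)) (s≤s (≤-reflexive end))

  a≡ : a ≡ map₂ G (map₂ F ℓ)
  a≡ = just-injective (begin
    just a                              ≡⟨ !-++-length w ⟨
    u ! length w                        ≡⟨ cong (u !_) end ⟨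
    u ! (p + (q + t))                   ≡⟨ F-per-wa (q + t) end<|u| ⟩
    Maybe.map (map₂ F) (u ! (q + t))    ≡⟨ cong (Maybe.map (map₂ F)) (!-++ˡ w q+t<n) ⟩
    Maybe.map (map₂ F) (w ! (q + t))    ≡⟨ cong (Maybe.map (map₂ F)) (G-per t q+t<n) ⟩
    Maybe.map (map₂ F) (Maybe.map (map₂ G) (w ! t))  ≡⟨ cong (Maybe.map (map₂ F) ∘ Maybe.map (map₂ G)) wt ⟩
    just (map₂ F (map₂ G ℓ))            ≡⟨ cong just commutes ⟩
    just (map₂ G (map₂ F ℓ))            ∎)

smallestPeriod-snoc-unchanged : {S P : Set} {w : PString S P} {a : S ⊎ P} {ps : List P} {c : P} {p q : ℕ} →
  (∀ d → inj₂ d ∈ w → d ∈ ps) → c ∈ ps → p * suc (length ps) ≤ length w →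
  IsSmallestPeriod p (w ++ a ∷ []) → IsSmallestPeriod q w → p ≡ q
smallestPeriod-snoc-unchanged {ps = []} _ () _ _ _
smallestPeriod-snoc-unchanged {w = w} {a} {ps = _ ∷ _} {p = p} {q} ps-complete _ long
  ((p>0 , _ , f , f-eq) , p-min) ((q>0 , q≤n , g , g-eq) , q-min) =
  [ ⊥-elim ∘ q-period-of-wa , sym ]′ (m≤n⇒m<n∨m≡n q≤p)
  where
  F-per-wa = map-take≡drop⇒periodic (w ++ a ∷ []) f-eq

  q≤p : q ≤ p
  q≤p = ≮⇒≥ λ p<q → q-min p p<q
    (p>0 , ≤-trans (m≤m*n p _) long , f , periodic⇒map-take≡drop w (periodic-++ˡ w F-per-wa))

  q-period-of-wa : q < p → ⊥
  q-period-of-wa q<p = p-min q q<p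
    ( q>0
    , subst (q ≤_) (sym (length-snoc w)) (m≤n⇒m≤1+n q≤n)
    , g
    , periodic⇒map-take≡drop (w ++ a ∷ [])
        (shorter-period-extends f g refl ps-complete q>0 q<p long F-per-wa (map-take≡drop⇒periodic w g-eq)))

lemma7 : {S P : Set} (w : PString S P) → w ≢ [] → (∃ λ (c : P) → inj₂ c ∈ w) →
    (a : S ⊎ P) (k p q : ℕ) → ParamCount w k →
    IsSmallestPeriod p (w ++ a ∷ []) → IsSmallestPeriod q w → p ≢ q →
    length w < p * suc k
lemma7 w _ (c , c∈w) a k p q (ps , _ , refl , ps≡Π) p-smallest q-smallest p≢q
  with length w <? p * suc (length ps)
... | yes short = short
... | no ¬short = ⊥-elim (p≢q
  (smallestPeriod-snoc-unchanged ps-complete (ps-complete c c∈w) (≮⇒≥ ¬short) p-smallest q-smallest))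
  where
  ps-complete : ∀ d → inj₂ d ∈ w → d ∈ ps
  ps-complete d = Equivalence.from (ps≡Π d)
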